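{- Let $q$ be a prime power, let $\mathbb{F}_q$ be the finite field with $q$ elements, let $W$ be an $n$-dimensional vector space over $\mathbb{F}_q$, and let $u,v$ be nonnegative integers. Let $\mathcal{S}=\{(U_i,V_i):1\le i\le m\}$ be a system of pairs of subspaces of $W$ such that (i) $\dim(U_i)=u$ and $\dim(V_i)=v$ for each $1\le i\le m$; (ii) $U_i\cap V_i=\{0\}$ for each $1\le i\le m$; (iii) for all $i\ne j$ ($1\le i,j\le m$), $U_i\cap V_j\ne\{0\}$ or $U_j\cap V_i\ne\{0\}$. Then $$m\le \left(\frac{q}{q-1}\right)^n q^{uv}.$$ -}

module Defs where

open import Level using (0ℓ)
open import Data.Nat using (ℕ; zero; suc)
open import Data.Fin using (Fin; zero; suc)
open import Data.Product using (Σ; ∃; _×_; _,_)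
open import Relation.Nullary using (¬_)
open import Algebra.Bundles using (CommutativeRing)
open import Function.Bundles using (Inverse)
import Relation.Binary.PropositionalEquality as ≡

record FiniteField (q : ℕ) : Set₁ where
  field
    commRing   : CommutativeRing 0ℓ 0ℓ
  open CommutativeRing commRing public hiding (ring)
  field
    1≉0        : ¬ (1# ≈ 0#)
    inverse    : ∀ x → ¬ (x ≈ 0#) → ∃ λ y → x * y ≈ 1#
    cardinal   : Inverse setoid (≡.setoid (Fin q))

module LinearAlgebra {q : ℕ} (F : FiniteField q) where
  open FiniteField F using (Carrier; _≈_; _+_; _*_; 0#)

  Vecₙ : ℕ → Set
  Vecₙ n = Fin n → Carrier

  _≈ᵥ_ : ∀ {n} → Vecₙ n → Vecₙ n → Set
  x ≈ᵥ y = ∀ i → x i ≈ y i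

  IsZero : ∀ {n} → Vecₙ n → Set
  IsZero x = ∀ i → x i ≈ 0#

  lincomb : ∀ {k n} → (Fin k → Carrier) → (Fin k → Vecₙ n) → Vecₙ n
  lincomb {zero}  c b i = 0#
  lincomb {suc k} c b i = c zero * b zero i + lincomb (λ j → c (suc j)) (λ j → b (suc j)) i

  LinIndep : ∀ {k n} → (Fin k → Vecₙ n) → Set
  LinIndep b = ∀ c → IsZero (lincomb c b) → ∀ j → c j ≈ 0#

  -- A subspace of dimension d of F^n, given by a basis (d linearly
  -- independent vectors); the subspace is their span.
  record Subspace (n d : ℕ) : Set where
    field
      basis   : Fin d → Vecₙ n
      indep   : LinIndep basis

  _∈ₛ_ : ∀ {n d} → Vecₙ n → Subspace n d → Set
  x ∈ₛ U = ∃ λ c → x ≈ᵥ lincomb c (Subspace.basis U)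

  TrivialMeet : ∀ {n d e} → Subspace n d → Subspace n e → Set
  TrivialMeet U V = ∀ x → x ∈ₛ U → x ∈ₛ V → IsZero x

  NontrivialMeet : ∀ {n d e} → Subspace n d → Subspace n e → Set
  NontrivialMeet U V = ∃ λ x → x ∈ₛ U × x ∈ₛ V × ¬ IsZero x

-- Identify W with Fⁿ and let a v-tuple φ of vectors act as the linear map Φ x = (⟨φₜ, x⟩)ₜ
-- from W to Fᵛ. Say that φ separates (U, V) if Φ vanishes on U and is injective on V. If φ
-- separated both (Uᵢ, Vᵢ) and (Uⱼ, Vⱼ) for i ≠ j, a nonzero x in Uᵢ ∩ Vⱼ (or in Uⱼ ∩ Vᵢ) would
-- satisfy both Φ x = 0 and Φ x ≠ 0, so the sets of tuples separating the m pairs are disjoint.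
-- As Uᵢ ∩ Vᵢ = {0}, a basis of Uᵢ followed by a basis of Vᵢ is independent, and Gaussian
-- elimination lets us prescribe the values of Φ on it freely, leaving n − u − v coordinates of
-- each φₜ free. Prescribing 0 on Uᵢ and an invertible matrix on Vᵢ yields at least
-- ((q − 1) q^(v − 1))^v · q^(v(n − u − v)) tuples separating (Uᵢ, Vᵢ). There are q^(nv) tuples
-- in all, so m (q − 1)^v ≤ q^(uv + v), and the bound follows from (q − 1)^(n − v) ≤ q^(n − v).

module Submission where

open import Defs
open import Data.Nat as ℕ using (ℕ; zero; suc; _∸_; _≤_; _<_; z≤n; s≤s)
import Data.Nat.Properties as ℕ
open import Data.Fin
  using (Fin; zero; suc; punchIn; punchOut; splitAt; _≟_; _↑ˡ_; _↑ʳ_; remQuot; combine; funToFin; finToFun)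
open import Data.Fin.Properties
  using ( ¬Fin0; ¬∀⟶∃¬; all?; splitAt⁻¹-↑ˡ; splitAt⁻¹-↑ʳ; punchIn-punchOut; punchIn-injective; punchInᵢ≢i
        ; *↔×; funToFin-finToFin; finToFun-funToFin; injective⇒≤)
open import Data.Product using (Σ; ∃; ∃₂; _×_; _,_; proj₁; proj₂; uncurry)
open import Data.Product.Properties using (×-≡,≡→≡)
open import Data.Sum using (_⊎_; inj₁; inj₂)
open import Data.Empty using (⊥-elim)
open import Data.Maybe using (nothing)
open import Data.Vec.Functional using (Vector; removeAt; insertAt; _∷_; _++_)
open import Data.Vec.Functional.Properties using (insertAt-punchIn; insertAt-lookup; lookup-++ˡ; lookup-++ʳ)
open import Function using (_∘_; _on_; Inverse; Injection)
open import Function.Definitions using (Injective)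
open import Function.Properties.Inverse using (Inverse⇒Injection)
open import Function.Construct.Symmetry using () renaming (inverse to inverse-sym)
open import Relation.Nullary using (¬_; Dec; yes; no)
open import Relation.Binary using (Rel; Decidable)
import Relation.Binary.PropositionalEquality as ≡
open ≡ using (_≡_; _≢_; _≗_)
open import Algebra.Bundles using (CommutativeRing)
open import Tactic.RingSolver.Core.AlmostCommutativeRing using (AlmostCommutativeRing; fromCommutativeRing)

-- Enumerations by Fin

remQuot-injective : ∀ {m} n → Injective _≡_ _≡_ (remQuot {m} n)
remQuot-injective {m} n = Injection.injective (Inverse⇒Injection (*↔× {m} {n}))

pairing : ∀ {a} {A : Set a} {m n} → (Fin m → Fin n → A) → Fin (m ℕ.* n) → A
pairing {n = n} f = uncurry f ∘ remQuot n

pairing-injective : ∀ {a ℓ} {A : Set a} (_~_ : Rel A ℓ) {m n} (f : Fin m → Fin n → A) →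
                    (∀ {i j i′ j′} → f i j ~ f i′ j′ → i ≡ i′ × j ≡ j′) →
                    Injective _≡_ _~_ (pairing f)
pairing-injective _ {n = n} f inj = remQuot-injective n ∘ ×-≡,≡→≡ ∘ inj

funToFin-cong : ∀ {m n} {f g : Fin m → Fin n} → f ≗ g → funToFin f ≡ funToFin g
funToFin-cong {zero}  f≗g = ≡.refl
funToFin-cong {suc m} f≗g = ≡.cong₂ combine (f≗g zero) (funToFin-cong (f≗g ∘ suc))

funToFin-injective : ∀ {m n} {f g : Fin m → Fin n} → funToFin f ≡ funToFin g → f ≗ g
funToFin-injective {f = f} {g} e i =
  ≡.trans (≡.sym (finToFun-funToFin f i)) (≡.trans (≡.cong (λ x → finToFun x i) e) (finToFun-funToFin g i))

finToFun-injective : ∀ {m n} {x y : Fin (m ℕ.^ n)} → finToFun {m} {n} x ≗ finToFun y → x ≡ y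
finToFun-injective {m} {n} {x} {y} e =
  ≡.trans (≡.sym (funToFin-finToFin {n} {m} x)) (≡.trans (funToFin-cong {n} {m} e) (funToFin-finToFin {n} {m} y))

others : ∀ {n} → Fin n → Fin (n ∸ 1) → Fin n
others {suc n} = punchIn

others-injective : ∀ {n} (o : Fin n) {i j} → others o i ≡ others o j → i ≡ j
others-injective {suc n} o = punchIn-injective o _ _

others≢ : ∀ {n} (o : Fin n) i → others o i ≢ o
others≢ {suc n} = punchInᵢ≢i

↑-cases : ∀ {u v} (P : Fin (u ℕ.+ v) → Set) → (∀ s → P (s ↑ˡ v)) → (∀ s → P (u ↑ʳ s)) → ∀ j → P j
↑-cases {u} P left right j with splitAt u j in eq
... | inj₁ s = ≡.subst P (splitAt⁻¹-↑ˡ eq) (left s)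
... | inj₂ s = ≡.subst P (splitAt⁻¹-↑ʳ eq) (right s)

-- Linear algebra over a finite field

module RingIdentities {c ℓ} (R : CommutativeRing c ℓ) where
  open import Tactic.RingSolver using (solve-∀)
  private
    ACR : AlmostCommutativeRing c ℓ
    ACR = fromCommutativeRing R (λ _ → nothing)
  open AlmostCommutativeRing ACR

  *-distrib-scaled : ∀ y a s b → y * (a + s * b) ≈ y * a + s * (y * b)
  *-distrib-scaled = solve-∀ ACR

  *-exchange : ∀ x c b → x * (c * b) ≈ c * (x * b)
  *-exchange = solve-∀ ACR

module _ {q : ℕ} (F : FiniteField q) where
  open FiniteField F hiding (zero)
  open LinearAlgebra F
  open RingIdentities commRing
  open import Algebra.Properties.Semiring.Sum semiring
  open import Algebra.Properties.Group +-group using (//-rightDividesˡ; //-rightDividesʳ; inverseˡ-unique; ε⁻¹≈ε)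
  open import Algebra.Properties.AbelianGroup +-abelianGroup using (⁻¹-∙-comm)
  open import Algebra.Properties.Ring (CommutativeRing.ring commRing) using (-‿distribˡ-*)
  open import Relation.Binary.Reasoning.Setoid setoid

  private
    module Card = Inverse cardinal

    ≡⇒≈ : ∀ {x y} → x ≡ y → x ≈ y
    ≡⇒≈ ≡.refl = refl


  to-injective : ∀ {x y} → Card.to x ≡ Card.to y → x ≈ y
  to-injective = Injection.injective (Inverse⇒Injection cardinal)

  from-injective : ∀ {i j} → Card.from i ≈ Card.from j → i ≡ j
  from-injective = Injection.injective (Inverse⇒Injection (inverse-sym cardinal))

  _≈?_ : Decidable _≈_
  x ≈? y with Card.to x ≟ Card.to y
  ... | yes e = yes (to-injective e)
  ... | no ne = no (ne ∘ Card.to-cong)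

  x*y≈0⇒x≈0 : ∀ {x y} → ¬ y ≈ 0# → x * y ≈ 0# → x ≈ 0#
  x*y≈0⇒x≈0 {x} {y} y≉0 xy≈0 with inverse y y≉0
  ... | y⁻¹ , yy⁻¹≈1 = begin
    x              ≈⟨ *-identityʳ x ⟨
    x * 1#         ≈⟨ *-congˡ yy⁻¹≈1 ⟨
    x * (y * y⁻¹)  ≈⟨ *-assoc x y y⁻¹ ⟨
    (x * y) * y⁻¹  ≈⟨ *-congʳ xy≈0 ⟩
    0# * y⁻¹       ≈⟨ zeroˡ y⁻¹ ⟩
    0#             ∎

  nonzero : Fin (q ∸ 1) → Carrier
  nonzero = Card.from ∘ others (Card.to 0#)

  nonzero≉0 : ∀ a → ¬ nonzero a ≈ 0#
  nonzero≉0 a e = others≢ (Card.to 0#) a (≡.trans (≡.sym (Card.strictlyInverseˡ _)) (Card.to-cong e))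

  nonzero-injective : ∀ {a b} → nonzero a ≈ nonzero b → a ≡ b
  nonzero-injective e = others-injective _ (from-injective e)

  encode : ∀ {k} → Vecₙ k → Fin (q ℕ.^ k)
  encode x = funToFin (Card.to ∘ x)

  encode-injective : ∀ {k} {x y : Vecₙ k} → encode x ≡ encode y → x ≈ᵥ y
  encode-injective e i = to-injective (funToFin-injective e i)

  decode : ∀ {k} → Fin (q ℕ.^ k) → Vecₙ k
  decode {k} a = Card.from ∘ finToFun {q} {k} a

  decode-injective : ∀ {k} {a b : Fin (q ℕ.^ k)} → decode a ≈ᵥ decode b → a ≡ b
  decode-injective {k} e = finToFun-injective {q} {k} (λ i → from-injective (e i))


  _≋_ : ∀ {k n} → Rel (Fin k → Vecₙ n) _
  b ≋ b′ = ∀ j → b j ≈ᵥ b′ j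

  sum-zero : ∀ {k} (f : Vector Carrier k) → (∀ j → f j ≈ 0#) → sum f ≈ 0#
  sum-zero {k} f f≈0 = trans (sum-cong-≋ f≈0) (sum-replicate-zero k)

  sum-↑ : ∀ {u v} (f : Vector Carrier (u ℕ.+ v)) → sum f ≈ ∑[ s < u ] f (s ↑ˡ v) + ∑[ s < v ] f (u ↑ʳ s)
  sum-↑ {zero}  f = sym (+-identityˡ _)
  sum-↑ {suc u} f = trans (+-congˡ (sum-↑ {u} (f ∘ suc))) (sym (+-assoc _ _ _))

  dot : ∀ {n} → Vecₙ n → Vecₙ n → Carrier
  dot {n} x y = ∑[ i < n ] (x i * y i)

  dot-cong : ∀ {n} {x x′ y y′ : Vecₙ n} → x ≈ᵥ x′ → y ≈ᵥ y′ → dot x y ≈ dot x′ y′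
  dot-cong x≈x′ y≈y′ = sum-cong-≋ (λ i → *-cong (x≈x′ i) (y≈y′ i))

  dot-congˡ : ∀ {n} {x x′ : Vecₙ n} y → x ≈ᵥ x′ → dot x y ≈ dot x′ y
  dot-congˡ y x≈x′ = dot-cong x≈x′ (λ i → refl {y i})

  dot-congʳ : ∀ {n} x {y y′ : Vecₙ n} → y ≈ᵥ y′ → dot x y ≈ dot x y′
  dot-congʳ x = dot-cong (λ i → refl {x i})

  dot-comm : ∀ {n} (x y : Vecₙ n) → dot x y ≈ dot y x
  dot-comm x y = sum-cong-≋ (λ i → *-comm (x i) (y i))

  dot-zeroʳ : ∀ {n} (x : Vecₙ n) {y} → IsZero y → dot x y ≈ 0#
  dot-zeroʳ x y≈0 = sum-zero _ (λ i → trans (*-congˡ (y≈0 i)) (zeroʳ _))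

  dot-removeAt : ∀ {n} (x y : Vecₙ (suc n)) i → dot x y ≈ x i * y i + dot (removeAt x i) (removeAt y i)
  dot-removeAt x y i = sum-remove (λ j → x j * y j)

  dot-linearʳ : ∀ {n} (y a b : Vecₙ n) s → dot y (λ i → a i + s * b i) ≈ dot y a + s * dot y b
  dot-linearʳ {n} y a b s = begin
    ∑[ i < n ] (y i * (a i + s * b i))        ≈⟨ sum-cong-≋ (λ i → *-distrib-scaled (y i) (a i) s (b i)) ⟩
    ∑[ i < n ] (y i * a i + s * (y i * b i))  ≈⟨ ∑-distrib-+ (λ i → y i * a i) (λ i → s * (y i * b i)) ⟩
    dot y a + ∑[ i < n ] (s * (y i * b i))    ≈⟨ +-congˡ (*-distribˡ-sum s (λ i → y i * b i)) ⟨
    dot y a + s * dot y b                     ∎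

  lincomb≡sum : ∀ {k n} (c : Fin k → Carrier) (b : Fin k → Vecₙ n) i → lincomb c b i ≡ ∑[ j < k ] (c j * b j i)
  lincomb≡sum {zero}  c b i = ≡.refl
  lincomb≡sum {suc k} c b i = ≡.cong (c zero * b zero i +_) (lincomb≡sum (c ∘ suc) (b ∘ suc) i)

  lincomb-cong : ∀ {k n} {c c′ : Fin k → Carrier} {b b′ : Fin k → Vecₙ n} →
                 (∀ j → c j ≈ c′ j) → b ≋ b′ → lincomb c b ≈ᵥ lincomb c′ b′
  lincomb-cong {c = c} {c′} {b} {b′} c≈c′ b≋b′ i = begin
    lincomb c b i               ≡⟨ lincomb≡sum c b i ⟩
    ∑[ j < _ ] (c j * b j i)    ≈⟨ sum-cong-≋ (λ j → *-cong (c≈c′ j) (b≋b′ j i)) ⟩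
    ∑[ j < _ ] (c′ j * b′ j i)  ≡⟨ lincomb≡sum c′ b′ i ⟨
    lincomb c′ b′ i             ∎

  lincomb-zeroˡ : ∀ {k n} (c : Fin k → Carrier) (b : Fin k → Vecₙ n) → (∀ j → c j ≈ 0#) → IsZero (lincomb c b)
  lincomb-zeroˡ c b c≈0 i = trans (≡⇒≈ (lincomb≡sum c b i)) (sum-zero _ (λ j → trans (*-congʳ (c≈0 j)) (zeroˡ _)))

  lincomb-zeroʳ : ∀ {k n} (c : Fin k → Carrier) (b : Fin k → Vecₙ n) i → (∀ j → b j i ≈ 0#) → lincomb c b i ≈ 0#
  lincomb-zeroʳ c b i b≈0 = trans (≡⇒≈ (lincomb≡sum c b i)) (sum-zero _ (λ j → trans (*-congˡ (b≈0 j)) (zeroʳ _)))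

  lincomb-neg : ∀ {k n} (c : Fin k → Carrier) (b : Fin k → Vecₙ n) i → lincomb (λ j → - c j) b i ≈ - lincomb c b i
  lincomb-neg {zero}  c b i = sym ε⁻¹≈ε
  lincomb-neg {suc k} c b i = begin
    - c zero * b zero i + lincomb (λ j → - c (suc j)) (b ∘ suc) i
      ≈⟨ +-cong (sym (-‿distribˡ-* _ _)) (lincomb-neg (c ∘ suc) (b ∘ suc) i) ⟩
    - (c zero * b zero i) + - lincomb (c ∘ suc) (b ∘ suc) i
      ≈⟨ ⁻¹-∙-comm _ _ ⟩
    - lincomb c b i
      ∎

  lincomb-affine : ∀ {k n} (d : Fin k → Carrier) (x : Fin k → Vecₙ n) (s : Fin k → Carrier) (y : Vecₙ n) i →
                   lincomb d (λ j i → x j i + s j * y i) i ≈ lincomb d x i + ∑[ j < k ] (d j * s j) * y i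
  lincomb-affine {k} d x s y i = begin
    lincomb d (λ j i → x j i + s j * y i) i
      ≡⟨ lincomb≡sum d _ i ⟩
    ∑[ j < k ] (d j * (x j i + s j * y i))
      ≈⟨ sum-cong-≋ (λ j → *-distrib-scaled (d j) (x j i) (s j) (y i)) ⟩
    ∑[ j < k ] (d j * x j i + s j * (d j * y i))
      ≈⟨ ∑-distrib-+ (λ j → d j * x j i) (λ j → s j * (d j * y i)) ⟩
    ∑[ j < k ] (d j * x j i) + ∑[ j < k ] (s j * (d j * y i))
      ≈⟨ +-cong (≡⇒≈ (≡.sym (lincomb≡sum d x i)))
                (sum-cong-≋ (λ j → trans (*-exchange (s j) (d j) (y i)) (sym (*-assoc _ _ _)))) ⟩
    lincomb d x i + ∑[ j < k ] (d j * s j * y i)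
      ≈⟨ +-congˡ (*-distribʳ-sum (y i) (λ j → d j * s j)) ⟨
    lincomb d x i + ∑[ j < k ] (d j * s j) * y i
      ∎

  lincomb-++ : ∀ {u v n} (c : Fin (u ℕ.+ v) → Carrier) (a : Fin u → Vecₙ n) (b : Fin v → Vecₙ n) i →
               lincomb c (a ++ b) i ≈ lincomb (c ∘ (_↑ˡ v)) a i + lincomb (c ∘ (u ↑ʳ_)) b i
  lincomb-++ {u} {v} c a b i = begin
    lincomb c (a ++ b) i
      ≡⟨ lincomb≡sum c (a ++ b) i ⟩
    ∑[ j < u ℕ.+ v ] (c j * (a ++ b) j i)
      ≈⟨ sum-↑ {u} _ ⟩
    ∑[ s < u ] (c (s ↑ˡ v) * (a ++ b) (s ↑ˡ v) i) + ∑[ s < v ] (c (u ↑ʳ s) * (a ++ b) (u ↑ʳ s) i)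
      ≡⟨ ≡.cong₂ _+_ (sum-cong-≗ (λ s → ≡.cong (λ x → c (s ↑ˡ v) * x i) (lookup-++ˡ a b s)))
                     (sum-cong-≗ (λ s → ≡.cong (λ x → c (u ↑ʳ s) * x i) (lookup-++ʳ a b s))) ⟩
    ∑[ s < u ] (c (s ↑ˡ v) * a s i) + ∑[ s < v ] (c (u ↑ʳ s) * b s i)
      ≡⟨ ≡.cong₂ _+_ (lincomb≡sum _ a i) (lincomb≡sum _ b i) ⟨
    lincomb (c ∘ (_↑ˡ v)) a i + lincomb (c ∘ (u ↑ʳ_)) b i
      ∎

  dot-lincomb : ∀ {k n} (x : Vecₙ n) (c : Fin k → Carrier) (b : Fin k → Vecₙ n) →
                dot x (lincomb c b) ≈ ∑[ j < k ] (c j * dot x (b j))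
  dot-lincomb {k} {n} x c b = begin
    ∑[ i < n ] (x i * lincomb c b i)             ≈⟨ sum-cong-≋ (λ i → *-congˡ (≡⇒≈ (lincomb≡sum c b i))) ⟩
    ∑[ i < n ] (x i * ∑[ j < k ] (c j * b j i))  ≈⟨ sum-cong-≋ (λ i → *-distribˡ-sum (x i) (λ j → c j * b j i)) ⟩
    ∑[ i < n ] ∑[ j < k ] (x i * (c j * b j i))  ≈⟨ sum-cong-≋ (λ i → sum-cong-≋ (λ j → *-exchange (x i) (c j) (b j i))) ⟩
    ∑[ i < n ] ∑[ j < k ] (c j * (x i * b j i))  ≈⟨ ∑-comm (λ i j → c j * (x i * b j i)) ⟩
    ∑[ j < k ] ∑[ i < n ] (c j * (x i * b j i))  ≈⟨ sum-cong-≋ (λ j → *-distribˡ-sum (c j) (λ i → x i * b j i)) ⟨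
    ∑[ j < k ] (c j * dot x (b j))               ∎


  nonzero-entry : ∀ {n} {x : Vecₙ n} → ¬ IsZero x → ∃ λ i → ¬ x i ≈ 0#
  nonzero-entry {n} {x} = ¬∀⟶∃¬ n _ (λ i → x i ≈? 0#)

  IsZero-removeAt : ∀ {n} {x : Vecₙ (suc n)} i → x i ≈ 0# → IsZero (removeAt x i) → IsZero x
  IsZero-removeAt {x = x} i xᵢ≈0 rest≈0 j with i ≟ j
  ... | yes ≡.refl = xᵢ≈0
  ... | no i≢j = ≡.subst (λ j → x j ≈ 0#) (punchIn-punchOut i≢j) (rest≈0 (punchOut i≢j))

  indep⇒nonzero : ∀ {k n} {b : Fin (suc k) → Vecₙ n} → LinIndep b → ¬ IsZero (b zero)
  indep⇒nonzero {b = b} ind b₀≈0 = 1≉0 (ind (1# ∷ λ _ → 0#) lincomb≈0 zero)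
    where
    lincomb≈0 : IsZero (lincomb (1# ∷ λ _ → 0#) b)
    lincomb≈0 i = begin
      1# * b zero i + lincomb (λ _ → 0#) (b ∘ suc) i
        ≈⟨ +-cong (trans (*-identityˡ _) (b₀≈0 i)) (lincomb-zeroˡ (λ _ → 0#) (b ∘ suc) (λ _ → refl) i) ⟩
      0# + 0#
        ≈⟨ +-identityˡ 0# ⟩
      0#
        ∎

  nonzero⇒indep : ∀ {n} {x : Vecₙ n} → ¬ IsZero x → LinIndep {1} (λ _ → x)
  nonzero⇒indep {x = x} x≉0 c hz zero with nonzero-entry x≉0
  ... | i , xᵢ≉0 = x*y≈0⇒x≈0 xᵢ≉0 (trans (sym (+-identityʳ _)) (hz i))

  LinIndep-cong : ∀ {k n} {b b′ : Fin k → Vecₙ n} → b ≋ b′ → LinIndep b → LinIndep b′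
  LinIndep-cong b≋b′ ind c hz = ind c (λ i → trans (lincomb-cong (λ _ → refl) b≋b′ i) (hz i))

  indep-∷ : ∀ {k n} {b : Fin k → Vecₙ n} {ℓ y : Vecₙ n} → LinIndep b →
            (∀ j → dot ℓ (b j) ≈ 0#) → ¬ dot ℓ y ≈ 0# → LinIndep (y ∷ b)
  indep-∷ {k} {b = b} {ℓ} {y} ind ℓ⊥b ℓy≉0 c hz = λ { zero → c₀≈0 ; (suc j) → ind (c ∘ suc) rest≈0 j }
    where
    c₀≈0 : c zero ≈ 0#
    c₀≈0 = x*y≈0⇒x≈0 ℓy≉0 (begin
      c zero * dot ℓ y                                         ≈⟨ +-identityʳ _ ⟨
      c zero * dot ℓ y + 0#                                    ≈⟨ +-congˡ (sum-zero _ (λ j → trans (*-congˡ (ℓ⊥b j)) (zeroʳ _))) ⟨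
      c zero * dot ℓ y + ∑[ j < k ] (c (suc j) * dot ℓ (b j))  ≈⟨ dot-lincomb ℓ c (y ∷ b) ⟨
      dot ℓ (lincomb c (y ∷ b))                                ≈⟨ dot-zeroʳ ℓ hz ⟩
      0#                                                       ∎)
    rest≈0 : IsZero (lincomb (c ∘ suc) b)
    rest≈0 i = trans (sym (+-identityˡ _)) (trans (+-congʳ (sym (trans (*-congʳ c₀≈0) (zeroˡ _)))) (hz i))

  trivialMeet⇒indep-++ : ∀ {n u v} (U : Subspace n u) (V : Subspace n v) → TrivialMeet U V →
                         LinIndep (Subspace.basis U ++ Subspace.basis V)
  trivialMeet⇒indep-++ {n} {u} {v} U V U∩V≈0 c hz = ↑-cases (λ j → c j ≈ 0#) cᵤ≈0 cᵥ≈0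
    where
    a : Fin u → Vecₙ n
    a = Subspace.basis U
    b : Fin v → Vecₙ n
    b = Subspace.basis V
    cᵤ : Fin u → Carrier
    cᵤ = c ∘ (_↑ˡ v)
    cᵥ : Fin v → Carrier
    cᵥ = c ∘ (u ↑ʳ_)
    x : Vecₙ n
    x = lincomb cᵤ a
    x+y≈0 : ∀ i → x i + lincomb cᵥ b i ≈ 0#
    x+y≈0 i = trans (sym (lincomb-++ c a b i)) (hz i)
    x∈V : x ∈ₛ V
    x∈V = (λ s → - cᵥ s) , λ i → trans (inverseˡ-unique _ _ (x+y≈0 i)) (sym (lincomb-neg cᵥ b i))
    x≈0 : IsZero x
    x≈0 = U∩V≈0 x (cᵤ , λ i → refl) x∈V
    cᵤ≈0 : ∀ s → cᵤ s ≈ 0#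
    cᵤ≈0 = Subspace.indep U cᵤ x≈0
    cᵥ≈0 : ∀ s → cᵥ s ≈ 0#
    cᵥ≈0 = Subspace.indep V cᵥ (λ i → trans (sym (+-identityˡ _)) (trans (+-congʳ (sym (x≈0 i))) (x+y≈0 i)))

  -- Gaussian elimination

  record DotSolutions {k n} (w : Fin k → Vecₙ n) (r : ℕ) : Set where
    field
      solution           : Vecₙ r → Vecₙ k → Vecₙ n
      solution-dot       : ∀ z c j → dot (solution z c) (w j) ≈ c j
      solution-injective : ∀ z z′ c c′ → solution z c ≈ᵥ solution z′ c′ → z ≈ᵥ z′

  -- The pivot w₀ i₀ clears coordinate i₀ from the other vectors, which then live in Fⁿ.
  module Elimination {k n} (w : Fin (suc k) → Vecₙ (suc n)) (i₀ : Fin (suc n)) (pivot≉0 : ¬ w zero i₀ ≈ 0#) where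
    pivot⁻¹ : Carrier
    pivot⁻¹ = proj₁ (inverse _ pivot≉0)

    *pivot⁻¹*pivot : ∀ x → x * pivot⁻¹ * w zero i₀ ≈ x
    *pivot⁻¹*pivot x =
      trans (*-assoc _ _ _) (trans (*-congˡ (trans (*-comm _ _) (proj₂ (inverse _ pivot≉0)))) (*-identityʳ x))

    factor : Fin k → Carrier
    factor j = w (suc j) i₀ * pivot⁻¹

    reduced : Fin k → Vecₙ (suc n)
    reduced j i = w (suc j) i - factor j * w zero i

    reduced-pivot : ∀ j → reduced j i₀ ≈ 0#
    reduced-pivot j = trans (+-congˡ (-‿cong (*pivot⁻¹*pivot _))) (-‿inverseʳ _)

    w≈reduced+factor*w₀ : ∀ j i → w (suc j) i ≈ reduced j i + factor j * w zero i
    w≈reduced+factor*w₀ j i = sym (//-rightDividesˡ _ _)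

    w′ : Fin k → Vecₙ n
    w′ j = removeAt (reduced j) i₀

    -- A vanishing combination of the reduced vectors is one of w with coefficient −S on w₀.
    w′-indep : LinIndep w → LinIndep w′
    w′-indep ind d hz j = ind (- S ∷ d) lincomb≈0 (suc j)
      where
      S : Carrier
      S = ∑[ j < k ] (d j * factor j)
      reduced-comb≈0 : IsZero (lincomb d reduced)
      reduced-comb≈0 = IsZero-removeAt i₀ (lincomb-zeroʳ d reduced i₀ reduced-pivot)
        (λ i → trans (≡⇒≈ (≡.trans (lincomb≡sum d reduced _) (≡.sym (lincomb≡sum d w′ i)))) (hz i))
      lincomb≈0 : IsZero (lincomb (- S ∷ d) w)
      lincomb≈0 i = begin
        - S * w zero i + lincomb d (w ∘ suc) i
          ≈⟨ +-cong (sym (-‿distribˡ-* _ _)) (lincomb-cong (λ _ → refl) w≈reduced+factor*w₀ i) ⟩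
        - (S * w zero i) + lincomb d (λ j i → reduced j i + factor j * w zero i) i
          ≈⟨ +-congˡ (lincomb-affine d reduced factor (w zero) i) ⟩
        - (S * w zero i) + (lincomb d reduced i + S * w zero i)
          ≈⟨ +-comm _ _ ⟩
        (lincomb d reduced i + S * w zero i) - S * w zero i
          ≈⟨ //-rightDividesʳ _ _ ⟩
        lincomb d reduced i
          ≈⟨ reduced-comb≈0 i ⟩
        0#
          ∎

    lift : ∀ {r} → DotSolutions w′ r → DotSolutions w r
    lift {r} S = record { solution = solution ; solution-dot = solution-dot ; solution-injective = solution-injective }
      where
      open DotSolutions S renaming (solution to g; solution-dot to g-dot; solution-injective to g-injective)
      reducedRHS : Vecₙ (suc k) → Vecₙ k
      reducedRHS c j = c (suc j) - factor j * c zero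
      rest : Vecₙ r → Vecₙ (suc k) → Vecₙ n
      rest z c = g z (reducedRHS c)
      pivotEntry : Vecₙ r → Vecₙ (suc k) → Carrier
      pivotEntry z c = (c zero - dot (rest z c) (removeAt (w zero) i₀)) * pivot⁻¹
      solution : Vecₙ r → Vecₙ (suc k) → Vecₙ (suc n)
      solution z c = insertAt (rest z c) i₀ (pivotEntry z c)

      removeAt-solution : ∀ z c → removeAt (solution z c) i₀ ≈ᵥ rest z c
      removeAt-solution z c i = ≡⇒≈ (insertAt-punchIn (rest z c) i₀ _ i)

      dot-solution : ∀ z c y → dot (solution z c) y ≈ pivotEntry z c * y i₀ + dot (rest z c) (removeAt y i₀)
      dot-solution z c y = trans (dot-removeAt (solution z c) y i₀)
        (+-cong (*-congʳ (≡⇒≈ (insertAt-lookup (rest z c) i₀ _))) (dot-congˡ (removeAt y i₀) (removeAt-solution z c)))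

      solution-dot₀ : ∀ z c → dot (solution z c) (w zero) ≈ c zero
      solution-dot₀ z c = trans (dot-solution z c (w zero)) (trans (+-congʳ (*pivot⁻¹*pivot _)) (//-rightDividesˡ _ _))

      solution-dot : ∀ z c j → dot (solution z c) (w j) ≈ c j
      solution-dot z c zero    = solution-dot₀ z c
      solution-dot z c (suc j) = begin
        dot (solution z c) (w (suc j))
          ≈⟨ dot-congʳ (solution z c) (w≈reduced+factor*w₀ j) ⟩
        dot (solution z c) (λ i → reduced j i + factor j * w zero i)
          ≈⟨ dot-linearʳ (solution z c) (reduced j) (w zero) (factor j) ⟩
        dot (solution z c) (reduced j) + factor j * dot (solution z c) (w zero)
          ≈⟨ +-cong (dot-solution z c (reduced j)) (*-congˡ (solution-dot₀ z c)) ⟩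
        (pivotEntry z c * reduced j i₀ + dot (rest z c) (w′ j)) + factor j * c zero
          ≈⟨ +-congʳ (+-cong (trans (*-congˡ (reduced-pivot j)) (zeroʳ _)) (g-dot z _ j)) ⟩
        (0# + reducedRHS c j) + factor j * c zero
          ≈⟨ +-congʳ (+-identityˡ _) ⟩
        reducedRHS c j + factor j * c zero
          ≈⟨ //-rightDividesˡ _ _ ⟩
        c (suc j)
          ∎

      solution-injective : ∀ z z′ c c′ → solution z c ≈ᵥ solution z′ c′ → z ≈ᵥ z′
      solution-injective z z′ c c′ e = g-injective z z′ (reducedRHS c) (reducedRHS c′) (λ i →
        trans (sym (removeAt-solution z c i)) (trans (e (punchIn i₀ i)) (removeAt-solution z′ c′ i)))

  dotSolutions : ∀ {k n} (w : Fin k → Vecₙ n) → LinIndep w → k ≤ n × DotSolutions w (n ∸ k)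
  dotSolutions {zero}  {n}     w ind = z≤n , record
    { solution = λ z _ → z ; solution-dot = λ _ _ () ; solution-injective = λ _ _ _ _ z≈z′ → z≈z′ }
  dotSolutions {suc k} {zero}  w ind = ⊥-elim (indep⇒nonzero {b = w} ind (λ ()))
  dotSolutions {suc k} {suc n} w ind with nonzero-entry (indep⇒nonzero {b = w} ind)
  ... | i₀ , pivot≉0 = s≤s (proj₁ reduction) , lift (proj₂ reduction)
    where
    open Elimination w i₀ pivot≉0
    reduction : k ≤ n × DotSolutions w′ (n ∸ k)
    reduction = dotSolutions w′ (w′-indep ind)

  -- Independent families

  #offHyperplane : ℕ → ℕ
  #offHyperplane v = (q ∸ 1) ℕ.* q ℕ.^ (v ∸ 1)

  module _ {v} {ℓ : Vecₙ v} (ℓ≉0 : ¬ IsZero ℓ) where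
    private
      open DotSolutions (proj₂ (dotSolutions (λ _ → ℓ) (nonzero⇒indep ℓ≉0)))

      withDotValue : Fin (q ∸ 1) → Fin (q ℕ.^ (v ∸ 1)) → Vecₙ v
      withDotValue a z = solution (decode z) (λ _ → nonzero a)

      dot-withDotValue : ∀ a z → dot ℓ (withDotValue a z) ≈ nonzero a
      dot-withDotValue a z = trans (dot-comm ℓ _) (solution-dot (decode z) _ zero)

    offHyperplane : Fin (#offHyperplane v) → Vecₙ v
    offHyperplane = pairing withDotValue

    dot-offHyperplane : ∀ d → ¬ dot ℓ (offHyperplane d) ≈ 0#
    dot-offHyperplane d e = nonzero≉0 _ (trans (sym (dot-withDotValue _ _)) e)

    offHyperplane-injective : Injective _≡_ _≈ᵥ_ offHyperplane
    offHyperplane-injective = pairing-injective _≈ᵥ_ withDotValue λ {a} {z} {a′} {z′} e →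
      nonzero-injective (trans (sym (dot-withDotValue a z)) (trans (dot-congʳ ℓ e) (dot-withDotValue a′ z′))) ,
      decode-injective (solution-injective _ _ _ _ e)

  -- Two distinct parameters cannot both give the zero vector.
  solutions⇒annihilator : ∀ {s v r} {b : Fin s → Vecₙ v} → DotSolutions b (suc r) →
                          ∃ λ ℓ → ¬ IsZero ℓ × (∀ j → dot ℓ (b j) ≈ 0#)
  solutions⇒annihilator {v = v} {r} {b} S = choose (all? (λ i → ℓ₀ i ≈? 0#))
    where
    open DotSolutions S
    e₀ : Vecₙ (suc r)
    e₀ = 1# ∷ λ _ → 0#
    ℓ₀ ℓ₁ : Vecₙ v
    ℓ₀ = solution (λ _ → 0#) (λ _ → 0#)
    ℓ₁ = solution e₀ (λ _ → 0#)
    choose : Dec (IsZero ℓ₀) → ∃ λ ℓ → ¬ IsZero ℓ × (∀ j → dot ℓ (b j) ≈ 0#)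
    choose (no ℓ₀≉0)  = ℓ₀ , ℓ₀≉0 , solution-dot _ _
    choose (yes ℓ₀≈0) = ℓ₁ , ℓ₁≉0 , solution-dot _ _
      where
      ℓ₁≉0 : ¬ IsZero ℓ₁
      ℓ₁≉0 ℓ₁≈0 = 1≉0 (solution-injective _ _ _ _ (λ i → trans (ℓ₁≈0 i) (sym (ℓ₀≈0 i))) zero)

  annihilator : ∀ {s v} {b : Fin s → Vecₙ v} → LinIndep b → s < v → ∃ λ ℓ → ¬ IsZero ℓ × (∀ j → dot ℓ (b j) ≈ 0#)
  annihilator {s} {v} {b} ind s<v with v ∸ s | ℕ.m<n⇒0<n∸m s<v | proj₂ (dotSolutions b ind)
  ... | suc r | _ | S = solutions⇒annihilator S

  module _ (v : ℕ) where
    Independent : ℕ → Set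
    Independent s = Σ (Fin s → Vecₙ v) LinIndep

    extend : ∀ {s} → Independent s → s < v → Fin (#offHyperplane v) → Independent (suc s)
    extend (b , ind) s<v d =
      let ℓ , ℓ≉0 , ℓ⊥b = annihilator ind s<v
      in (offHyperplane ℓ≉0 d ∷ b) , indep-∷ ind ℓ⊥b (dot-offHyperplane ℓ≉0 d)

    independents : ∀ s → s ≤ v → Fin (#offHyperplane v ℕ.^ s) → Independent s
    independents zero    _   _ = (λ ()) , (λ _ _ ())
    independents (suc s) s<v = pairing (λ d x → extend (independents s (ℕ.<⇒≤ s<v) x) s<v d)

    independents-injective : ∀ s (s≤v : s ≤ v) → Injective _≡_ (_≋_ on proj₁) (independents s s≤v)
    independents-injective zero    _   {zero} {zero} _ = ≡.refl
    independents-injective (suc s) s<v = pairing-injective (_≋_ on proj₁) extension joint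
      where
      extension : Fin (#offHyperplane v) → Fin (#offHyperplane v ℕ.^ s) → Independent (suc s)
      extension d x = extend (independents s (ℕ.<⇒≤ s<v) x) s<v d
      joint : ∀ {d x d′ x′} → proj₁ (extension d x) ≋ proj₁ (extension d′ x′) → d ≡ d′ × x ≡ x′
      joint e with independents-injective s (ℕ.<⇒≤ s<v) (e ∘ suc)
      ... | ≡.refl = offHyperplane-injective _ (e zero) , ≡.refl

  -- Tuples of functionals separating a pair of subspaces

  functionals : ∀ {n v} → (Fin v → Vecₙ n) → Vecₙ n → Vecₙ v
  functionals φ x t = dot (φ t) x

  functionals-lincomb : ∀ {k n v} (φ : Fin v → Vecₙ n) (c : Fin k → Carrier) (b : Fin k → Vecₙ n) →
                        functionals φ (lincomb c b) ≈ᵥ lincomb c (functionals φ ∘ b)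
  functionals-lincomb φ c b t = trans (dot-lincomb (φ t) c b) (≡⇒≈ (≡.sym (lincomb≡sum c (functionals φ ∘ b) t)))

  record Separates {n u e v} (φ : Fin v → Vecₙ n) (U : Subspace n u) (V : Subspace n e) : Set where
    field
      kills    : ∀ s → IsZero (functionals φ (Subspace.basis U s))
      indep-on : LinIndep (functionals φ ∘ Subspace.basis V)

  separates⇒¬nontrivialMeet : ∀ {n u e v} {φ : Fin v → Vecₙ n} {U : Subspace n u} {V : Subspace n e} →
                              Separates φ U V → ¬ NontrivialMeet U V
  separates⇒¬nontrivialMeet {n} {u} {e} {φ = φ} {U} {V} sep (x , (c , x≈ca) , (d , x≈db) , x≉0) =
    x≉0 (λ i → trans (x≈db i) (lincomb-zeroˡ d b d≈0 i))
    where
    open Separates sep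
    a : Fin u → Vecₙ n
    a = Subspace.basis U
    b : Fin e → Vecₙ n
    b = Subspace.basis V
    φx≈0 : IsZero (functionals φ x)
    φx≈0 t = begin
      dot (φ t) x                      ≈⟨ dot-congʳ (φ t) x≈ca ⟩
      functionals φ (lincomb c a) t    ≈⟨ functionals-lincomb φ c a t ⟩
      lincomb c (functionals φ ∘ a) t  ≈⟨ lincomb-zeroʳ c _ t (λ s → kills s t) ⟩
      0#                               ∎
    d≈0 : ∀ s → d s ≈ 0#
    d≈0 = indep-on d (λ t →
      trans (sym (functionals-lincomb φ d b t)) (trans (dot-congʳ (φ t) (λ i → sym (x≈db i))) (φx≈0 t)))

  Separates-resp-≋ : ∀ {n u e v} {φ ψ : Fin v → Vecₙ n} {U : Subspace n u} {V : Subspace n e} →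
                     φ ≋ ψ → Separates φ U V → Separates ψ U V
  Separates-resp-≋ φ≋ψ sep = record
    { kills    = λ s t → trans (dot-congˡ _ (λ i → sym (φ≋ψ t i))) (kills s t)
    ; indep-on = LinIndep-cong (λ s t → dot-congˡ _ (φ≋ψ t)) indep-on
    }
    where open Separates sep

  Separates-cross : ∀ {n u u′ e e′ v} {φ ψ : Fin v → Vecₙ n} {U : Subspace n u} {V : Subspace n e}
                      {U′ : Subspace n u′} {V′ : Subspace n e′} →
                    φ ≋ ψ → Separates φ U V → Separates ψ U′ V′ → Separates φ U V′
  Separates-cross φ≋ψ sep sep′ = record
    { kills    = Separates.kills sep
    ; indep-on = Separates.indep-on (Separates-resp-≋ (λ t i → sym (φ≋ψ t i)) sep′)
    }

  -- (#offHyperplane v)^v is a lower bound for the number of invertible v × v matrices.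
  #separating : ℕ → ℕ → ℕ → ℕ
  #separating n u v = #offHyperplane v ℕ.^ v ℕ.* (q ℕ.^ (n ∸ (u ℕ.+ v))) ℕ.^ v

  module _ {n u v} (U : Subspace n u) (V : Subspace n v) (U∩V≈0 : TrivialMeet U V) where
    private
      a : Fin u → Vecₙ n
      a = Subspace.basis U
      b : Fin v → Vecₙ n
      b = Subspace.basis V
      open DotSolutions (proj₂ (dotSolutions (a ++ b) (trivialMeet⇒indep-++ U V U∩V≈0)))

      images : Fin (#offHyperplane v ℕ.^ v) → Fin v → Vecₙ v
      images c = proj₁ (independents v v ℕ.≤-refl c)

      separating′ : Fin (#offHyperplane v ℕ.^ v) → Fin ((q ℕ.^ (n ∸ (u ℕ.+ v))) ℕ.^ v) → Fin v → Vecₙ n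
      separating′ c z t = solution (decode (finToFun z t)) ((λ _ → 0#) ++ λ s → images c s t)

      dot-basisU : ∀ c z t s → dot (separating′ c z t) (a s) ≈ 0#
      dot-basisU c z t s = begin
        dot (separating′ c z t) (a s)                ≡⟨ ≡.cong (dot _) (lookup-++ˡ a b s) ⟨
        dot (separating′ c z t) ((a ++ b) (s ↑ˡ v))  ≈⟨ solution-dot _ _ (s ↑ˡ v) ⟩
        ((λ _ → 0#) ++ λ s → images c s t) (s ↑ˡ v)  ≡⟨ lookup-++ˡ _ _ s ⟩
        0#                                           ∎

      dot-basisV : ∀ c z t s → dot (separating′ c z t) (b s) ≈ images c s t
      dot-basisV c z t s = begin
        dot (separating′ c z t) (b s)                ≡⟨ ≡.cong (dot _) (lookup-++ʳ a b s) ⟨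
        dot (separating′ c z t) ((a ++ b) (u ↑ʳ s))  ≈⟨ solution-dot _ _ (u ↑ʳ s) ⟩
        ((λ _ → 0#) ++ λ s → images c s t) (u ↑ʳ s)  ≡⟨ lookup-++ʳ {m = u} (λ _ → 0#) (λ s → images c s t) s ⟩
        images c s t                                 ∎

    trivialMeet⇒+≤ : u ℕ.+ v ≤ n
    trivialMeet⇒+≤ = proj₁ (dotSolutions (a ++ b) (trivialMeet⇒indep-++ U V U∩V≈0))

    separating : Fin (#separating n u v) → Fin v → Vecₙ n
    separating = pairing separating′

    separating-separates : ∀ x → Separates (separating x) U V
    separating-separates x = record
      { kills    = λ s t → dot-basisU _ _ t s
      ; indep-on = LinIndep-cong (λ s t → sym (dot-basisV _ _ t s)) (proj₂ (independents v v ℕ.≤-refl _))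
      }

    separating-injective : Injective _≡_ _≋_ separating
    separating-injective = pairing-injective _≋_ separating′ λ {c} {z} {c′} {z′} e →
      independents-injective v v ℕ.≤-refl (λ s t →
        trans (sym (dot-basisV c z t s)) (trans (dot-congˡ (b s) (e t)) (dot-basisV c′ z′ t s))) ,
      finToFun-injective (λ t → decode-injective (solution-injective _ _ _ _ (e t)))

  separating-count : ∀ {n u v m} (U : Fin m → Subspace n u) (V : Fin m → Subspace n v) →
                     (∀ i → TrivialMeet (U i) (V i)) →
                     (∀ i j → i ≢ j → NontrivialMeet (U i) (V j) ⊎ NontrivialMeet (U j) (V i)) →
                     m ℕ.* #separating n u v ≤ (q ℕ.^ n) ℕ.^ v
  separating-count {n} {u} {v} {m} U V U∩V≈0 crossing = injective⇒≤ (pairing-injective _≡_ code joint)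
    where
    φ : Fin m → Fin (#separating n u v) → Fin v → Vecₙ n
    φ i = separating (U i) (V i) (U∩V≈0 i)
    sep : ∀ i x → Separates (φ i x) (U i) (V i)
    sep i = separating-separates (U i) (V i) (U∩V≈0 i)
    code : Fin m → Fin (#separating n u v) → Fin ((q ℕ.^ n) ℕ.^ v)
    code i x = funToFin (encode ∘ φ i x)
    code-injective : ∀ {i x j y} → code i x ≡ code j y → φ i x ≋ φ j y
    code-injective e t = encode-injective (funToFin-injective e t)
    joint : ∀ {i x j y} → code i x ≡ code j y → i ≡ j × x ≡ y
    joint {i} {x} {j} {y} e with i ≟ j
    ... | yes ≡.refl = ≡.refl , separating-injective (U i) (V i) (U∩V≈0 i) (code-injective e)
    ... | no i≢j with crossing i j i≢j
    ...   | inj₁ meetᵢⱼ =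
      ⊥-elim (separates⇒¬nontrivialMeet (Separates-cross (code-injective e) (sep i x) (sep j y)) meetᵢⱼ)
    ...   | inj₂ meetⱼᵢ =
      ⊥-elim (separates⇒¬nontrivialMeet (Separates-cross (code-injective (≡.sym e)) (sep j y) (sep i x)) meetⱼᵢ)

-- Arithmetic

module _ where
  open import Data.Nat using (_+_; _*_; _^_; NonZero)
  open import Data.Nat.Properties
  open import Data.Nat.Tactic.RingSolver using (solve-∀)
  open ≤-Reasoning

  ^-distribʳ-* : ∀ a b k → (a * b) ^ k ≡ a ^ k * b ^ k
  ^-distribʳ-* a b zero    = ≡.refl
  ^-distribʳ-* a b (suc k) = ≡.trans (≡.cong ((a * b) *_) (^-distribʳ-* a b k)) (interchange a b (a ^ k) (b ^ k))
    where
    interchange : ∀ a b x y → (a * b) * (x * y) ≡ (a * x) * (b * y)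
    interchange = solve-∀

  count⇒bound : ∀ q m n u v .{{_ : NonZero q}} → u + v ≤ n →
                m * (((q ∸ 1) * q ^ (v ∸ 1)) ^ v * (q ^ (n ∸ (u + v))) ^ v) ≤ (q ^ n) ^ v →
                m * (q ∸ 1) ^ n ≤ q ^ n * q ^ (u * v)
  count⇒bound q m n u v u+v≤n count with n ∸ (u + v) | m+[n∸m]≡n u+v≤n
  ... | R | ≡.refl = begin
    m * A ^ (u + v + R)                  ≡⟨ ≡.cong (λ e → m * A ^ e) (reorder u v R) ⟩
    m * A ^ (v + (u + R))                ≡⟨ ≡.cong (m *_) (^-distribˡ-+-* A v (u + R)) ⟩
    m * (A ^ v * A ^ (u + R))            ≡⟨ *-assoc m _ _ ⟨
    m * A ^ v * A ^ (u + R)              ≤⟨ *-mono-≤ cancelled (^-monoˡ-≤ (u + R) (m∸n≤m q 1)) ⟩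
    q ^ (u * v) * q ^ v * q ^ (u + R)    ≡⟨ *-assoc (q ^ (u * v)) _ _ ⟩
    q ^ (u * v) * (q ^ v * q ^ (u + R))  ≡⟨ ≡.cong (q ^ (u * v) *_) (^-distribˡ-+-* q v (u + R)) ⟨
    q ^ (u * v) * q ^ (v + (u + R))      ≡⟨ ≡.cong (λ e → q ^ (u * v) * q ^ e) (reorder u v R) ⟨
    q ^ (u * v) * q ^ (u + v + R)        ≡⟨ *-comm (q ^ (u * v)) _ ⟩
    q ^ (u + v + R) * q ^ (u * v)        ∎
    where
    A E : ℕ
    A = q ∸ 1
    E = (v ∸ 1) * v + R * v
    instance
      qᴱ≢0 : NonZero (q ^ E)
      qᴱ≢0 = m^n≢0 q E

    reorder : ∀ u v R → u + v + R ≡ v + (u + R)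
    reorder = solve-∀

    regroup : ∀ m a b c → m * ((a * b) * c) ≡ m * a * (b * c)
    regroup = solve-∀

    exponent : ∀ u v R → (u + v + R) * v ≡ (u * v + v) + ((v ∸ 1) * v + R * v)
    exponent u zero    R = zero-case u R
      where
      zero-case : ∀ u R → (u + 0 + R) * 0 ≡ (u * 0 + 0) + (0 * 0 + R * 0)
      zero-case = solve-∀
    exponent u (suc v) R = suc-case u v R
      where
      suc-case : ∀ u v R → (u + suc v + R) * suc v ≡ (u * suc v + suc v) + (v * suc v + R * suc v)
      suc-case = solve-∀

    lhs : m * ((A * q ^ (v ∸ 1)) ^ v * (q ^ R) ^ v) ≡ m * A ^ v * q ^ E
    lhs = begin-equality
      m * ((A * q ^ (v ∸ 1)) ^ v * (q ^ R) ^ v)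
        ≡⟨ ≡.cong (λ x → m * (x * (q ^ R) ^ v)) (^-distribʳ-* A _ v) ⟩
      m * ((A ^ v * (q ^ (v ∸ 1)) ^ v) * (q ^ R) ^ v)
        ≡⟨ ≡.cong₂ (λ x y → m * ((A ^ v * x) * y)) (^-*-assoc q (v ∸ 1) v) (^-*-assoc q R v) ⟩
      m * ((A ^ v * q ^ ((v ∸ 1) * v)) * q ^ (R * v))
        ≡⟨ regroup m (A ^ v) _ _ ⟩
      m * A ^ v * (q ^ ((v ∸ 1) * v) * q ^ (R * v))
        ≡⟨ ≡.cong (m * A ^ v *_) (^-distribˡ-+-* q ((v ∸ 1) * v) (R * v)) ⟨
      m * A ^ v * q ^ E
        ∎

    rhs : (q ^ (u + v + R)) ^ v ≡ q ^ (u * v) * q ^ v * q ^ E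
    rhs = begin-equality
      (q ^ (u + v + R)) ^ v    ≡⟨ ^-*-assoc q (u + v + R) v ⟩
      q ^ ((u + v + R) * v)    ≡⟨ ≡.cong (q ^_) (exponent u v R) ⟩
      q ^ ((u * v + v) + E)    ≡⟨ ^-distribˡ-+-* q (u * v + v) E ⟩
      q ^ (u * v + v) * q ^ E  ≡⟨ ≡.cong (_* q ^ E) (^-distribˡ-+-* q (u * v) v) ⟩
      q ^ (u * v) * q ^ v * q ^ E  ∎

    cancelled : m * A ^ v ≤ q ^ (u * v) * q ^ v
    cancelled = *-cancelʳ-≤ _ _ (q ^ E) (≡.subst₂ _≤_ lhs rhs count)

open import Data.Nat using (_*_; _^_)
open import Data.Nat.Primality using (Prime)

theorem1p10 : (q : ℕ) → (∃₂ λ p k → Prime p × q ≡ p ^ suc k) → (F : FiniteField q) →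
              (n u v m : ℕ) →
              (U : Fin m → LinearAlgebra.Subspace F n u) →
              (V : Fin m → LinearAlgebra.Subspace F n v) →
              (∀ i → LinearAlgebra.TrivialMeet F (U i) (V i)) →
              (∀ i j → i ≢ j → LinearAlgebra.NontrivialMeet F (U i) (V j) ⊎ LinearAlgebra.NontrivialMeet F (U j) (V i)) →
              m * (q ∸ 1) ^ n ≤ q ^ n * q ^ (u * v)
theorem1p10 zero      _ F _ _ _ _       _ _ _     _        =
  ⊥-elim (¬Fin0 (Inverse.to (FiniteField.cardinal F) (FiniteField.0# F)))
theorem1p10 (suc _)   _ F n u v zero    U V U∩V≈0 crossing = z≤n
theorem1p10 q@(suc _) _ F n u v (suc m) U V U∩V≈0 crossing =
  count⇒bound q (suc m) n u v (trivialMeet⇒+≤ F (U zero) (V zero) (U∩V≈0 zero))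
              (separating-count F U V U∩V≈0 crossing)
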